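{- Let $(U,\varphi)$ be a finite standard closure space whose lattice of closed sets is modular, let $C$ be a non-join-irreducible essential set with predecessors $C_1,\dots,C_m$, and $C_*=C_1\cap\dots\cap C_m$. Let $\Sigma_E(\cdot)$ denote the closure operator induced by the $E$-base. Then for every quasi-closed set $Q$ with $\varphi(Q)=C$, $$\Sigma_E(Q)=Q\cup\{x\in U: C_i\setminus C_*=\{x\}\text{ for some } i\in\{1,\dots,m\}\}.$$
   Context: $(U,\varphi)$: finite set with closure operator; closed sets form a lattice under inclusion; standard: $\varphi(\{x\})\setminus\{x\}$ closed for all $x$. Predecessor of $C$: closed $C'\subsetneq C$ with no closed set strictly between; join-irreducible: exactly one predecessor. Quasi-closed $Q$: for all $X\subseteq Q$ with $\varphi(X)\subsetneq\varphi(Q)$, $\varphi(X)\subseteq Q$; pseudo-closed $P$: not closed and inclusion-minimal among quasi-closed $Q$ with $\varphi(Q)=\varphi(P)$; essential: $\varphi(P)$ for $P$ pseudo-closed. $\varphi^b(X)=\bigcup_{y\in X}\varphi(\{y\})$. $D$-generator of $x$: $A$ with $x\in\varphi(A)$, $x\notin\varphi^b(A)$, and $x\notin\varphi(B)$ whenever $\varphi^b(B)\subsetneq\varphi^b(A)$; $E$-generator: a $D$-generator $A$ with $\varphi(A)$ inclusion-minimal among closures of $D$-generators of $x$. $E$-base $\Sigma_E=\{a\to x: x\neq a,x\in\varphi(\{a\})\}\cup\{A\to x: A \text{ an } E\text{ -generator of } x\}$; $\Sigma_E(X)$ is the smallest superset $Z$ of $X$ such that $A\subseteq Z$ implies $x\in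 Z$ for all $A\to x\in\Sigma_E$. -}

module Defs where

open import Data.Nat using (ℕ)
open import Data.Fin using (Fin)
open import Data.Fin.Subset public
  using (Subset; _∈_; _∉_; _⊆_; _∩_; _∪_; _─_; ⁅_⁆; ⋃; ⋂; ⊥)
open import Data.Vec using (Vec; tabulate; toList; lookup)
open import Data.Bool using (if_then_else_)
open import Data.Product using (Σ; ∃; _×_; _,_)
open import Data.Sum using (_⊎_)
open import Relation.Nullary using (¬_)
open import Relation.Binary.PropositionalEquality using (_≡_; _≢_)

record ClosureOp (n : ℕ) : Set where
  field
    φ         : Subset n → Subset n
    extensive : ∀ X → X ⊆ φ X
    monotone  : ∀ {X Y} → X ⊆ Y → φ X ⊆ φ Y
    idempotent : ∀ X → φ (φ X) ≡ φ X

_⊊_ : ∀ {n} → Subset n → Subset n → Set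
X ⊊ Y = X ⊆ Y × X ≢ Y

module _ {n : ℕ} (cl : ClosureOp n) where
  open ClosureOp cl

  Closed : Subset n → Set
  Closed X = φ X ≡ X

  Standard : Set
  Standard = ∀ x → Closed (φ ⁅ x ⁆ ─ ⁅ x ⁆)

  -- lattice of closed sets: meet = ∩, join = φ(∪); modular law
  Modular : Set
  Modular = ∀ A B D → Closed A → Closed B → Closed D → A ⊆ D →
            φ (A ∪ (B ∩ D)) ≡ φ (A ∪ B) ∩ D

  Predecessor : Subset n → Subset n → Set
  Predecessor C' C = Closed C' × C' ⊊ C ×
                     (∀ D → Closed D → ¬ (C' ⊊ D × D ⊊ C))

  JoinIrreducible : Subset n → Set
  JoinIrreducible C = Σ (Subset n) λ P → Predecessor P C ×
                      (∀ P' → Predecessor P' C → P' ≡ P)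

  QuasiClosed : Subset n → Set
  QuasiClosed Q = ∀ X → X ⊆ Q → φ X ⊊ φ Q → φ X ⊆ Q

  PseudoClosed : Subset n → Set
  PseudoClosed P = ¬ Closed P × QuasiClosed P ×
                   (∀ Q → QuasiClosed Q → φ Q ≡ φ P → ¬ (Q ⊊ P))

  Essential : Subset n → Set
  Essential C = Σ (Subset n) λ P → PseudoClosed P × φ P ≡ C

  φb : Subset n → Subset n
  φb X = ⋃ (toList (tabulate λ y → if lookup X y then φ ⁅ y ⁆ else ⊥))

  DGenerator : Fin n → Subset n → Set
  DGenerator x A = x ∈ φ A × x ∉ φb A ×
                   (∀ B → φb B ⊊ φb A → x ∉ φ B)

  EGenerator : Fin n → Subset n → Set
  EGenerator x A = DGenerator x A × (∀ B → DGenerator x B → ¬ (φ B ⊊ φ A))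

  ERule : Subset n → Fin n → Set
  ERule A x = (∃ λ a → A ≡ ⁅ a ⁆ × x ≢ a × x ∈ φ ⁅ a ⁆) ⊎ EGenerator x A

  -- x ∈ Σ_E(X): the least superset of X closed under the rules of Σ_E
  data _∈ΣE_ (x : Fin n) (X : Subset n) : Set where
    base : x ∈ X → x ∈ΣE X
    step : (A : Subset n) → ERule A x → (∀ y → y ∈ A → y ∈ΣE X) → x ∈ΣE X

⋂ᶠ : ∀ {n m} → (Fin m → Subset n) → Subset n
⋂ᶠ Cs = ⋂ (toList (tabulate Cs))

{-# OPTIONS --safe #-}
module Submission where

-- Let C* be the meet of the predecessors C_i of C. A maximal closed subset of Q either contains Q or
-- closes to C when joined with one more point of Q; by modularity this forces a whole predecessor of C
-- into Q, and a point of Q outside it forces a second one, so C* ⊆ Q.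
-- Soundness: a rule A → x with φ(A) ⊊ C lies below some C_k, so x is in Q unless it is the point of
-- C_k ∖ C*. A rule with φ(A) = C comes from an E-generator. If x ∉ Q, then x lies in some C_j, and every
-- w ≠ x of C_j lies in every predecessor P. Otherwise, if x ∉ P, then {w} ∪ (C_j ∩ P) generates C_j while
-- none of its points generates x, giving a D-generator of x with closure inside C_j ⊊ φ(A); and if x ∈ P,
-- modularity would put one of the two predecessors inside Q into the other. Hence C_j ∖ C* = {x}.
-- Completeness: if C_i ∖ C* = {x} with x ∉ Q, a D-generator of x inside Q is an E-generator, because a
-- D-generator with smaller closure lies below C_i and would generate x from the closed set C*.

open import Defs
open import Data.Bool using (true; false; if_then_else_) renaming (_≟_ to _≟ᵇ_)
open import Data.Empty using (⊥-elim)
open import Data.Fin using (Fin; zero; suc; _≟_)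
open import Data.Fin.Properties using (any?)
open import Data.Fin.Subset using (inside; outside; _⊂_; _⊃_; ⊤)
open import Data.Fin.Subset.Induction using (⊂-wellFounded; ⊃-wellFounded)
open import Data.Fin.Subset.Properties
  using (_∈?_; _⊆?_; anySubset?; ⊆-antisym; ⊆-reflexive; ⊆-min; ⊆⊤; ∈⊤; ∉⊥; x∈⁅x⁆; x∈⁅y⁆⇒x≡y;
         x≢y⇒x∉⁅y⁆; p∩q⊆p; p∩q⊆q; x∈p∩q⁺; x∈p∩q⁻; p⊆p∪q; q⊆p∪q; x∈p∪q⁺; x∈p∪q⁻; p─q⊆p;
         x∈p∧x∉q⇒x∈p─q)
open import Data.Nat using (ℕ; zero; suc)
open import Data.Product using (∃; ∃₂; _×_; _,_; proj₁; proj₂)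
open import Data.Sum using (_⊎_; inj₁; inj₂; [_,_]′)
open import Data.Vec using (_∷_; here; there; tabulate; toList; lookup)
open import Data.Vec.Properties using (≡-dec; []=⇒lookup; lookup⇒[]=)
open import Function using (_∘_)
open import Function.Bundles using (_⇔_; mk⇔)
open import Induction.WellFounded using (Acc; acc)
open import Relation.Nullary using (¬_; Dec; yes; no; ¬?)
open import Relation.Nullary.Decidable using (_×-dec_; decidable-stable)
open import Relation.Unary using (Decidable)
open import Relation.Binary.PropositionalEquality using (_≡_; _≢_; refl; sym; trans; subst)

x∈p─q⇒x∉q : ∀ {n x} (p q : Subset n) → x ∈ p ─ q → x ∉ q
x∈p─q⇒x∉q (_ ∷ p) (outside ∷ q) here ()
x∈p─q⇒x∉q (_ ∷ p) (inside ∷ q) () here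
x∈p─q⇒x∉q (_ ∷ p) (_ ∷ q) (there x∈) (there x∈q) = x∈p─q⇒x∉q p q x∈ x∈q

module _ {n : ℕ} where

  _≟ₛ_ : (X Y : Subset n) → Dec (X ≡ Y)
  _≟ₛ_ = ≡-dec _≟ᵇ_

  _⊊?_ : (X Y : Subset n) → Dec (X ⊊ Y)
  X ⊊? Y = (X ⊆? Y) ×-dec ¬? (X ≟ₛ Y)

  ⊈⇒∃ : ∀ {X Y : Subset n} → ¬ (X ⊆ Y) → ∃ λ z → z ∈ X × z ∉ Y
  ⊈⇒∃ {X} {Y} X⊈Y = decidable-stable (any? λ z → (z ∈? X) ×-dec ¬? (z ∈? Y)) λ ∄ →
    X⊈Y λ {z} z∈X → decidable-stable (z ∈? Y) λ z∉Y → ∄ (z , z∈X , z∉Y)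

  ⊊⇒⊂ : ∀ {X Y : Subset n} → X ⊊ Y → X ⊂ Y
  ⊊⇒⊂ {X} {Y} (X⊆Y , X≢Y) =
    X⊆Y , ⊈⇒∃ λ Y⊆X → X≢Y (⊆-antisym X⊆Y Y⊆X)

  ∪-least : ∀ {X Y Z : Subset n} → X ⊆ Z → Y ⊆ Z → X ∪ Y ⊆ Z
  ∪-least {X} {Y} X⊆Z Y⊆Z z∈ with x∈p∪q⁻ X Y z∈
  ... | inj₁ z∈X = X⊆Z z∈X
  ... | inj₂ z∈Y = Y⊆Z z∈Y

  ⁅⁆-⊆ : ∀ {y} {X : Subset n} → y ∈ X → ⁅ y ⁆ ⊆ X
  ⁅⁆-⊆ {y} {X} y∈X z∈⁅y⁆ = subst (_∈ X) (sym (x∈⁅y⁆⇒x≡y y z∈⁅y⁆)) y∈X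

  ∈∧∉⇒≢ : ∀ {y z} {X : Subset n} → y ∈ X → z ∉ X → y ≢ z
  ∈∧∉⇒≢ {X = X} y∈X z∉X y≡z = z∉X (subst (_∈ X) y≡z y∈X)

  module _ {p q : Subset n} {a : Fin n} (p─q≡⁅a⁆ : p ─ q ≡ ⁅ a ⁆) where

    ─≡⁅⁆⇒∈ : a ∈ p
    ─≡⁅⁆⇒∈ = p─q⊆p p q (subst (a ∈_) (sym p─q≡⁅a⁆) (x∈⁅x⁆ a))

    ─≡⁅⁆⇒∉ : a ∉ q
    ─≡⁅⁆⇒∉ = x∈p─q⇒x∉q p q (subst (a ∈_) (sym p─q≡⁅a⁆) (x∈⁅x⁆ a))

    ─≡⁅⁆⇒≡ : ∀ {z} → z ∈ p → z ∉ q → z ≡ a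
    ─≡⁅⁆⇒≡ {z} z∈p z∉q = x∈⁅y⁆⇒x≡y a (subst (z ∈_) p─q≡⁅a⁆ (x∈p∧x∉q⇒x∈p─q z∈p z∉q))

  ─≡⁅⁆ : ∀ {p q : Subset n} {a} → a ∈ p → a ∉ q → (∀ {z} → z ∈ p → z ≢ a → z ∈ q) → p ─ q ≡ ⁅ a ⁆
  ─≡⁅⁆ {p} {q} {a} a∈p a∉q rest⊆q = ⊆-antisym ⊆⁅a⁆ (⁅⁆-⊆ (x∈p∧x∉q⇒x∈p─q a∈p a∉q))
    where
    ⊆⁅a⁆ : p ─ q ⊆ ⁅ a ⁆
    ⊆⁅a⁆ {z} z∈ with z ≟ a
    ... | yes refl = x∈⁅x⁆ a
    ... | no z≢a = ⊥-elim (x∈p─q⇒x∉q p q z∈ (rest⊆q (p─q⊆p p q z∈) z≢a))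

  ∈⋃ᶠ⁻ : ∀ {m x} (Xs : Fin m → Subset n) → x ∈ ⋃ (toList (tabulate Xs)) → ∃ λ i → x ∈ Xs i
  ∈⋃ᶠ⁻ {zero} Xs x∈ = ⊥-elim (∉⊥ x∈)
  ∈⋃ᶠ⁻ {suc m} Xs x∈ with x∈p∪q⁻ (Xs zero) _ x∈
  ... | inj₁ x∈X₀ = zero , x∈X₀
  ... | inj₂ x∈⋃ with ∈⋃ᶠ⁻ (Xs ∘ suc) x∈⋃
  ...   | i , x∈Xᵢ = suc i , x∈Xᵢ

  ∈⋃ᶠ⁺ : ∀ {m x} (Xs : Fin m → Subset n) i → x ∈ Xs i → x ∈ ⋃ (toList (tabulate Xs))
  ∈⋃ᶠ⁺ Xs zero x∈X₀ = x∈p∪q⁺ (inj₁ x∈X₀)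
  ∈⋃ᶠ⁺ Xs (suc i) x∈Xᵢ = x∈p∪q⁺ (inj₂ (∈⋃ᶠ⁺ (Xs ∘ suc) i x∈Xᵢ))

  ∈⋂ᶠ⁻ : ∀ {m x} (Xs : Fin m → Subset n) → x ∈ ⋂ᶠ Xs → ∀ i → x ∈ Xs i
  ∈⋂ᶠ⁻ {suc m} Xs x∈ zero = proj₁ (x∈p∩q⁻ _ _ x∈)
  ∈⋂ᶠ⁻ {suc m} Xs x∈ (suc i) = ∈⋂ᶠ⁻ (Xs ∘ suc) (proj₂ (x∈p∩q⁻ _ _ x∈)) i

  ∈⋂ᶠ⁺ : ∀ {m x} (Xs : Fin m → Subset n) → (∀ i → x ∈ Xs i) → x ∈ ⋂ᶠ Xs
  ∈⋂ᶠ⁺ {zero} Xs _ = ∈⊤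
  ∈⋂ᶠ⁺ {suc m} Xs x∈Xs = x∈p∩q⁺ (x∈Xs zero , ∈⋂ᶠ⁺ (Xs ∘ suc) (x∈Xs ∘ suc))

  maximal-extension : (S : Subset n → Set) → Decidable S → ∀ {D} → S D →
                      ∃ λ M → S M × D ⊆ M × (∀ E → S E → ¬ (M ⊊ E))
  maximal-extension S S? {D} SD = go D (⊃-wellFounded D) SD
    where
    go : ∀ D → Acc _⊃_ D → S D → ∃ λ M → S M × D ⊆ M × (∀ E → S E → ¬ (M ⊊ E))
    go D (acc larger) SD with anySubset? (λ E → S? E ×-dec (D ⊊? E))
    ... | no ∄ = D , SD , (λ z∈ → z∈) , λ E SE D⊊E → ∄ (E , SE , D⊊E)
    ... | yes (E , SE , D⊊E) with go E (larger (⊊⇒⊂ D⊊E)) SE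
    ...   | M , SM , E⊆M , M-maximal = M , SM , (λ z∈ → E⊆M (proj₁ D⊊E z∈)) , M-maximal

module ClosureProperties {n : ℕ} (cl : ClosureOp n) where
  open ClosureOp cl

  φ-least : ∀ {X D} → Closed cl D → X ⊆ D → φ X ⊆ D
  φ-least {X} D-closed X⊆D = subst (φ X ⊆_) D-closed (monotone X⊆D)

  φ⁅⁆-least : ∀ {y D} → Closed cl D → y ∈ D → φ ⁅ y ⁆ ⊆ D
  φ⁅⁆-least D-closed y∈D = φ-least D-closed (⁅⁆-⊆ y∈D)

  y∈φ⁅y⁆ : ∀ y → y ∈ φ ⁅ y ⁆
  y∈φ⁅y⁆ y = extensive ⁅ y ⁆ (x∈⁅x⁆ y)

  ∩-closed : ∀ {X Y} → Closed cl X → Closed cl Y → Closed cl (X ∩ Y)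
  ∩-closed {X} {Y} X-closed Y-closed = ⊆-antisym
    (λ z∈ → x∈p∩q⁺ (φ-least X-closed (p∩q⊆p X Y) z∈ , φ-least Y-closed (p∩q⊆q X Y) z∈))
    (extensive (X ∩ Y))

  ⋂ᶠ-closed : ∀ {m} (Xs : Fin m → Subset n) → (∀ i → Closed cl (Xs i)) → Closed cl (⋂ᶠ Xs)
  ⋂ᶠ-closed {zero} Xs _ = ⊆-antisym ⊆⊤ (extensive ⊤)
  ⋂ᶠ-closed {suc m} Xs Xs-closed =
    ∩-closed (Xs-closed zero) (⋂ᶠ-closed (Xs ∘ suc) (Xs-closed ∘ suc))

  ∈φb⁻ : ∀ {X x} → x ∈ φb cl X → ∃ λ y → y ∈ X × x ∈ φ ⁅ y ⁆
  ∈φb⁻ {X} x∈ with ∈⋃ᶠ⁻ _ x∈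
  ... | y , x∈ᵧ with lookup X y in lookup≡
  ...   | true = y , lookup⇒[]= y X lookup≡ , x∈ᵧ
  ...   | false = ⊥-elim (∉⊥ x∈ᵧ)

  φb-least : ∀ {X D} → (∀ {y} → y ∈ X → φ ⁅ y ⁆ ⊆ D) → φb cl X ⊆ D
  φb-least φ⁅⁆⊆D x∈ with ∈φb⁻ x∈
  ... | y , y∈X , x∈φy = φ⁅⁆⊆D y∈X x∈φy

  ⊆φb : ∀ X → X ⊆ φb cl X
  ⊆φb X {y} y∈X = ∈⋃ᶠ⁺ _ y
    (subst (λ b → y ∈ (if b then φ ⁅ y ⁆ else ⊥)) (sym ([]=⇒lookup y∈X)) (y∈φ⁅y⁆ y))

  φb⊆φ : ∀ X → φb cl X ⊆ φ X
  φb⊆φ X = φb-least λ y∈X → monotone (⁅⁆-⊆ y∈X)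

  φ-mono-φb : ∀ {X Y} → φb cl X ⊆ φb cl Y → φ X ⊆ φ Y
  φ-mono-φb {X} {Y} φbX⊆φbY = φ-least (idempotent Y) λ z∈X → φb⊆φ Y (φbX⊆φbY (⊆φb X z∈X))

  ERule⇒∈φ : ∀ {A x} → ERule cl A x → x ∈ φ A
  ERule⇒∈φ (inj₁ (a , refl , _ , x∈φa)) = x∈φa
  ERule⇒∈φ (inj₂ ((x∈φA , _) , _)) = x∈φA

  dGenerator-within : ∀ x Z → x ∈ φ Z → x ∉ φb cl Z →
                      ∃ λ B → DGenerator cl x B × φb cl B ⊆ φb cl Z
  dGenerator-within x Z = go Z (⊂-wellFounded (φb cl Z))
    where
    go : ∀ Z → Acc _⊂_ (φb cl Z) → x ∈ φ Z → x ∉ φb cl Z →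
         ∃ λ B → DGenerator cl x B × φb cl B ⊆ φb cl Z
    go Z (acc smaller) x∈φZ x∉φbZ with anySubset? (λ B → (φb cl B ⊊? φb cl Z) ×-dec (x ∈? φ B))
    ... | no ∄ = Z , (x∈φZ , x∉φbZ , λ B φbB⊊φbZ x∈φB → ∄ (B , φbB⊊φbZ , x∈φB)) , λ z∈ → z∈
    ... | yes (B , (φbB⊆φbZ , φbB≢φbZ) , x∈φB)
      with go B (smaller (⊊⇒⊂ (φbB⊆φbZ , φbB≢φbZ))) x∈φB (λ x∈ → x∉φbZ (φbB⊆φbZ x∈))
    ...   | G , G-gen , φbG⊆φbB = G , G-gen , λ z∈ → φbB⊆φbZ (φbG⊆φbB z∈)

  ∉φ-of-─≡⁅⁆ : ∀ {P Z B x} → Closed cl Z → P ─ Z ≡ ⁅ x ⁆ → φ B ⊆ P → x ∉ φb cl B → x ∉ φ B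
  ∉φ-of-─≡⁅⁆ {P} {Z} {B} {x} Z-closed P─Z≡⁅x⁆ φB⊆P x∉φbB x∈φB =
    ─≡⁅⁆⇒∉ P─Z≡⁅x⁆ (φ-least Z-closed φbB⊆Z (monotone (⊆φb B) x∈φB))
    where
    φbB⊆Z : φb cl B ⊆ Z
    φbB⊆Z {z} z∈ = decidable-stable (z ∈? Z) λ z∉Z →
      x∉φbB (subst (_∈ φb cl B) (─≡⁅⁆⇒≡ P─Z≡⁅x⁆ (φB⊆P (φb⊆φ B z∈)) z∉Z) z∈)

  predecessor-⊉ : ∀ {P C} → Predecessor cl P C → ¬ (C ⊆ P)
  predecessor-⊉ (_ , (P⊆C , P≢C) , _) C⊆P = P≢C (⊆-antisym P⊆C C⊆P)

  ⊆-predecessor⇒⊊ : ∀ {X P C} → Predecessor cl P C → X ⊆ P → X ⊊ C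
  ⊆-predecessor⇒⊊ {X} {P} P-pred@(_ , (P⊆C , _) , _) X⊆P =
    (λ z∈ → P⊆C (X⊆P z∈)) , λ X≡C → predecessor-⊉ P-pred (subst (_⊆ P) X≡C X⊆P)

  predecessor-⊆⇒≡ : ∀ {P P' C} → Predecessor cl P C → Predecessor cl P' C → P ⊆ P' → P ≡ P'
  predecessor-⊆⇒≡ (_ , _ , nothing-between) (P'-closed , P'⊊C , _) P⊆P' =
    decidable-stable (_ ≟ₛ _) λ P≢P' → nothing-between _ P'-closed ((P⊆P' , P≢P') , P'⊊C)

  ⊊φ∪ : ∀ {X P z} → z ∈ X → z ∉ P → P ⊊ φ (X ∪ P)
  ⊊φ∪ {X} {P} {z} z∈X z∉P =
    (λ u∈ → extensive _ (q⊆p∪q X P u∈)) ,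
    λ P≡ → z∉P (subst (z ∈_) (sym P≡) (extensive _ (p⊆p∪q P z∈X)))

  predecessor-join : ∀ {C P X z} → Closed cl C → Predecessor cl P C → X ⊆ C → z ∈ X → z ∉ P →
                     φ (X ∪ P) ≡ C
  predecessor-join {C} {P} {X} C-closed (_ , (P⊆C , _) , nothing-between) X⊆C z∈X z∉P =
    decidable-stable (_ ≟ₛ _) λ φ[X∪P]≢C → nothing-between _ (idempotent _)
      (⊊φ∪ z∈X z∉P , φ-least C-closed (∪-least X⊆C P⊆C) , φ[X∪P]≢C)

  predecessor-above : ∀ {C D} → Closed cl D → D ⊊ C → ∃ λ P → Predecessor cl P C × D ⊆ P
  predecessor-above {C} D-closed D⊊C
    with maximal-extension (λ E → Closed cl E × E ⊊ C) (λ E → (φ E ≟ₛ E) ×-dec (E ⊊? C))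
                           (D-closed , D⊊C)
  ... | P , (P-closed , P⊊C) , D⊆P , P-maximal =
    P , (P-closed , P⊊C , λ E E-closed (P⊊E , E⊊C) → P-maximal E (E-closed , E⊊C) P⊊E) , D⊆P

  quasiClosed-φ : ∀ {Q X} → QuasiClosed cl Q → X ⊆ Q → φ X ≢ φ Q → φ X ⊆ Q
  quasiClosed-φ Q-qc X⊆Q φX≢φQ = Q-qc _ X⊆Q (monotone X⊆Q , φX≢φQ)

  maximal-closed-⊆ : ∀ {Q D} → QuasiClosed cl Q → Closed cl D → D ⊆ Q →
                     ∃ λ M → Closed cl M × M ⊆ Q × (∀ {y} → y ∈ Q → y ∉ M → φ (⁅ y ⁆ ∪ M) ≡ φ Q)
  maximal-closed-⊆ {Q} Q-qc D-closed D⊆Q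
    with maximal-extension (λ E → Closed cl E × E ⊆ Q) (λ E → (φ E ≟ₛ E) ×-dec (E ⊆? Q))
                           (D-closed , D⊆Q)
  ... | M , (M-closed , M⊆Q) , _ , M-maximal = M , M-closed , M⊆Q , maximal
    where
    maximal : ∀ {y} → y ∈ Q → y ∉ M → φ (⁅ y ⁆ ∪ M) ≡ φ Q
    maximal {y} y∈Q y∉M = decidable-stable (_ ≟ₛ _) λ φ[y∪M]≢φQ →
      M-maximal _ (idempotent _ , quasiClosed-φ Q-qc (∪-least (⁅⁆-⊆ y∈Q) M⊆Q) φ[y∪M]≢φQ)
                (⊊φ∪ (x∈⁅x⁆ y) y∉M)

module StandardClosure {n : ℕ} (cl : ClosureOp n) (std : Standard cl) where
  open ClosureOp cl
  open ClosureProperties cl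

  φ⁅⁆-joinIrreducible : ∀ y → JoinIrreducible cl (φ ⁅ y ⁆)
  φ⁅⁆-joinIrreducible y = P , P-pred , unique
    where
    P = φ ⁅ y ⁆ ─ ⁅ y ⁆

    ⊆P : ∀ {D} → D ⊆ φ ⁅ y ⁆ → y ∉ D → D ⊆ P
    ⊆P D⊆ y∉D z∈D = x∈p∧x∉q⇒x∈p─q (D⊆ z∈D) (x≢y⇒x∉⁅y⁆ (∈∧∉⇒≢ z∈D y∉D))

    ∉-proper : ∀ {D} → Closed cl D → D ⊊ φ ⁅ y ⁆ → y ∉ D
    ∉-proper D-closed (D⊆ , D≢) y∈D = D≢ (⊆-antisym D⊆ (φ⁅⁆-least D-closed y∈D))

    P-pred : Predecessor cl P (φ ⁅ y ⁆)
    P-pred = std y , P⊊ , λ D D-closed ((P⊆D , P≢D) , D⊊) →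
               P≢D (⊆-antisym P⊆D (⊆P (proj₁ D⊊) (∉-proper D-closed D⊊)))
      where
      P⊊ : P ⊊ φ ⁅ y ⁆
      P⊊ = p─q⊆p _ _ , λ P≡ → x∈p─q⇒x∉q _ _ (subst (y ∈_) (sym P≡) (y∈φ⁅y⁆ y)) (x∈⁅x⁆ y)

    unique : ∀ P' → Predecessor cl P' (φ ⁅ y ⁆) → P' ≡ P
    unique P' P'-pred@(P'-closed , P'⊊ , _) =
      predecessor-⊆⇒≡ P'-pred P-pred (⊆P (proj₁ P'⊊) (∉-proper P'-closed P'⊊))

module ModularClosure {n : ℕ} (cl : ClosureOp n) (mod : Modular cl) where
  open ClosureOp cl
  open ClosureProperties cl

  modular-⊆ : ∀ {A X B} → Closed cl A → Closed cl X → Closed cl B → A ⊆ B → B ⊆ φ (A ∪ X) →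
              B ⊆ φ (A ∪ (X ∩ B))
  modular-⊆ {A} {X} {B} A-closed X-closed B-closed A⊆B B⊆ {z} z∈B =
    subst (z ∈_) (sym (mod A X B A-closed X-closed B-closed A⊆B)) (x∈p∩q⁺ (B⊆ z∈B , z∈B))

  predecessor-⊆-quasiClosed : ∀ {Q P D y} → QuasiClosed cl Q → Predecessor cl P (φ Q) →
                              Closed cl D → D ⊆ Q → y ∈ Q → y ∈ P → φ Q ⊆ φ (⁅ y ⁆ ∪ D) → P ⊆ Q
  predecessor-⊆-quasiClosed {Q} {P} {D} {y} Q-qc P-pred@(P-closed , (P⊆φQ , _) , _)
                            D-closed D⊆Q y∈Q y∈P φQ⊆ z∈P =
    E⊆Q (φ-least (idempotent Y) (∪-least (λ u∈ → u∈) D∩P⊆E)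
           (modular-⊆ (idempotent Y) D-closed P-closed E⊆P P⊆φ[E∪D] z∈P))
    where
    Y = ⁅ y ⁆ ∪ (D ∩ P)
    E = φ Y

    D∩P⊆E : D ∩ P ⊆ E
    D∩P⊆E u∈ = extensive Y (q⊆p∪q _ _ u∈)

    E⊆P : E ⊆ P
    E⊆P = φ-least P-closed (∪-least (⁅⁆-⊆ y∈P) (p∩q⊆q D P))

    E⊆Q : E ⊆ Q
    E⊆Q = quasiClosed-φ Q-qc (∪-least (⁅⁆-⊆ y∈Q) (λ u∈ → D⊆Q (p∩q⊆p D P u∈)))
                         (proj₂ (⊆-predecessor⇒⊊ P-pred E⊆P))

    P⊆φ[E∪D] : P ⊆ φ (E ∪ D)
    P⊆φ[E∪D] u∈ = monotone (∪-least (λ v∈ → p⊆p∪q D (extensive Y (p⊆p∪q _ v∈))) (q⊆p∪q E D))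
                           (φQ⊆ (P⊆φQ u∈))

  module Predecessors {C} (C-closed : Closed cl C) where

    ∩-predecessor-covered : ∀ {P D L z} → Predecessor cl P C → Closed cl D → D ⊆ C →
                            Closed cl L → P ∩ D ⊆ L → L ⊆ D → z ∈ L → z ∉ P → D ⊆ L
    ∩-predecessor-covered {P} {D} {L} P-pred@(P-closed , _) D-closed D⊆C L-closed P∩D⊆L L⊆D z∈L z∉P =
      λ u∈D → φ-least L-closed (∪-least (λ v∈ → v∈) P∩D⊆L)
                (modular-⊆ L-closed P-closed D-closed L⊆D D⊆φ[L∪P] u∈D)
      where
      D⊆φ[L∪P] : D ⊆ φ (L ∪ P)
      D⊆φ[L∪P] u∈D = ⊆-reflexive (sym (predecessor-join C-closed P-pred (λ v∈ → D⊆C (L⊆D v∈)) z∈L z∉P))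
                                 (D⊆C u∈D)

    module _ (std : Standard cl) where

      φ⁅⁆─⁅⁆-⊆-predecessor : ∀ {P D w} → Predecessor cl P C → Closed cl D → D ⊆ C → w ∈ D → w ∉ P →
                             φ ⁅ w ⁆ ─ ⁅ w ⁆ ⊆ P
      φ⁅⁆─⁅⁆-⊆-predecessor {P} {D} {w} P-pred@(P-closed , _) D-closed D⊆C w∈D w∉P {z} z∈W =
        decidable-stable (z ∈? P) λ z∉P → x∈p─q⇒x∉q _ _ (w∈W z∉P) (x∈⁅x⁆ w)
        where
        W = φ ⁅ w ⁆ ─ ⁅ w ⁆
        L = φ (W ∪ (P ∩ D))

        W⊆φw : W ⊆ φ ⁅ w ⁆
        W⊆φw = p─q⊆p _ _

        L⊆D : L ⊆ D
        L⊆D = φ-least D-closed (∪-least (λ u∈ → φ⁅⁆-least D-closed w∈D (W⊆φw u∈)) (p∩q⊆q P D))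

        W∪[P∩D∩φw]⊆W : W ∪ ((P ∩ D) ∩ φ ⁅ w ⁆) ⊆ W
        W∪[P∩D∩φw]⊆W = ∪-least (λ u∈ → u∈) λ u∈ →
          x∈p∧x∉q⇒x∈p─q (p∩q⊆q _ _ u∈)
                        (x≢y⇒x∉⁅y⁆ (∈∧∉⇒≢ (p∩q⊆p P D (p∩q⊆p _ _ u∈)) w∉P))

        w∈W : z ∉ P → w ∈ W
        w∈W z∉P = φ-least (std w) W∪[P∩D∩φw]⊆W
          (modular-⊆ (std w) (∩-closed P-closed D-closed) (idempotent _) W⊆φw
                     (φ⁅⁆-least (idempotent _) (D⊆L w∈D)) (y∈φ⁅y⁆ w))
          where
          D⊆L : D ⊆ L
          D⊆L = ∩-predecessor-covered P-pred D-closed D⊆C (idempotent _)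
                  (λ u∈ → extensive _ (q⊆p∪q W _ u∈)) L⊆D (extensive _ (p⊆p∪q _ z∈W)) z∉P

      module EGeneratorOf {x A} (A-gen : EGenerator cl x A) (φA≡C : φ A ≡ C) where

        ∈-avoiding-predecessor : ∀ {P D w} → Predecessor cl P C → Predecessor cl D C →
                                 x ∈ D → x ∉ P → w ∈ D → w ≢ x → w ∈ P
        ∈-avoiding-predecessor {P} {D} {w} P-pred@(P-closed , _) D-pred@(D-closed , (D⊆C , _) , _)
                               x∈D x∉P w∈D w≢x = decidable-stable (w ∈? P) ¬w∉P
          where
          Z = ⁅ w ⁆ ∪ (P ∩ D)

          φZ⊆D : φ Z ⊆ D
          φZ⊆D = φ-least D-closed (∪-least (⁅⁆-⊆ w∈D) (p∩q⊆q P D))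

          ¬w∉P : ¬ (w ∉ P)
          ¬w∉P w∉P with dGenerator-within x Z (D⊆φZ x∈D) x∉φbZ
            where
            D⊆φZ : D ⊆ φ Z
            D⊆φZ = ∩-predecessor-covered P-pred D-closed D⊆C (idempotent Z)
                     (λ u∈ → extensive Z (q⊆p∪q _ _ u∈)) φZ⊆D (extensive Z (p⊆p∪q _ (x∈⁅x⁆ w))) w∉P

            x∉φbZ : x ∉ φb cl Z
            x∉φbZ x∈ with ∈φb⁻ x∈
            ... | y , y∈Z , x∈φy with x∈p∪q⁻ _ _ y∈Z
            ...   | inj₂ y∈P∩D = x∉P (φ⁅⁆-least P-closed (p∩q⊆p P D y∈P∩D) x∈φy)
            ...   | inj₁ y∈⁅w⁆ with x∈⁅y⁆⇒x≡y w y∈⁅w⁆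
            ...     | refl = x∉P (φ⁅⁆─⁅⁆-⊆-predecessor P-pred D-closed D⊆C w∈D w∉P
                                    (x∈p∧x∉q⇒x∈p─q x∈φy (x≢y⇒x∉⁅y⁆ (w≢x ∘ sym))))
          ... | B , B-gen , φbB⊆φbZ = proj₂ A-gen B B-gen
                (subst (φ B ⊊_) (sym φA≡C) (⊆-predecessor⇒⊊ D-pred (λ u∈ → φZ⊆D (φ-mono-φb φbB⊆φbZ u∈))))

        ∈-every-predecessor : ∀ {Pa Pb D P w} → Predecessor cl Pa C → Predecessor cl Pb C → Pa ≢ Pb →
                              x ∉ Pa → x ∉ Pb → Predecessor cl D C → Predecessor cl P C →
                              x ∈ D → w ∈ D → w ≢ x → w ∈ P
        ∈-every-predecessor {Pa} {Pb} {D} {P} {w}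
                            Pa-pred@(Pa-closed , (Pa⊆C , _) , _) Pb-pred@(Pb-closed , _) Pa≢Pb x∉Pa x∉Pb
                            D-pred@(D-closed , (D⊆C , _) , _) P-pred@(P-closed , _) x∈D w∈D w≢x with x ∈? P | w ∈? P
        ... | no x∉P | _ = ∈-avoiding-predecessor P-pred D-pred x∈D x∉P w∈D w≢x
        ... | yes _ | yes w∈P = w∈P
        ... | yes x∈P | no w∉P = ⊥-elim (Pa≢Pb (predecessor-⊆⇒≡ Pa-pred Pb-pred Pa⊆Pb))
          where
          ∈Pb : ∀ {Y u} → Predecessor cl Y C → x ∈ Y → u ∈ Y ∩ Pa → u ∈ Pb
          ∈Pb Y-pred x∈Y u∈ = ∈-avoiding-predecessor Pb-pred Y-pred x∈Y x∉Pb
                                (p∩q⊆p _ _ u∈) (∈∧∉⇒≢ (p∩q⊆q _ _ u∈) x∉Pa)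

          w∈D∩Pa : w ∈ D ∩ Pa
          w∈D∩Pa = x∈p∩q⁺ (w∈D , ∈-avoiding-predecessor Pa-pred D-pred x∈D x∉Pa w∈D w≢x)

          Pa⊆φ[D∩Pa∪P] : Pa ⊆ φ ((D ∩ Pa) ∪ P)
          Pa⊆φ[D∩Pa∪P] u∈ = ⊆-reflexive
            (sym (predecessor-join C-closed P-pred (λ v∈ → D⊆C (p∩q⊆p D Pa v∈)) w∈D∩Pa w∉P)) (Pa⊆C u∈)

          -- Pa = (D ∩ Pa) ∨ (P ∩ Pa) by modularity, and both meets avoid x, hence lie in Pb.
          Pa⊆Pb : Pa ⊆ Pb
          Pa⊆Pb u∈ = φ-least Pb-closed (∪-least (∈Pb D-pred x∈D) (∈Pb P-pred x∈P))
            (modular-⊆ (∩-closed D-closed Pa-closed) P-closed Pa-closed (p∩q⊆q D Pa) Pa⊆φ[D∩Pa∪P] u∈)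

module EBaseClosure {n : ℕ} (cl : ClosureOp n) (std : Standard cl) (mod : Modular cl)
  (C : Subset n) (C-essential : Essential cl C) (C-notJI : ¬ JoinIrreducible cl C)
  (m : ℕ) (Cs : Fin m → Subset n) (Cs-pred : ∀ i → Predecessor cl (Cs i) C)
  (Cs-all : ∀ P → Predecessor cl P C → ∃ λ i → Cs i ≡ P)
  (Q : Subset n) (Q-qc : QuasiClosed cl Q) (φQ≡C : ClosureOp.φ cl Q ≡ C) where
  open ClosureOp cl
  open ClosureProperties cl
  open StandardClosure cl std
  open ModularClosure cl mod

  C* : Subset n
  C* = ⋂ᶠ Cs

  New : Fin n → Set
  New x = ∃ λ i → Cs i ─ C* ≡ ⁅ x ⁆

  Q⁺ : Fin n → Set
  Q⁺ x = x ∈ Q ⊎ New x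

  C-closed : Closed cl C
  C-closed = subst (Closed cl) φQ≡C (idempotent Q)

  open Predecessors C-closed

  Cs-closed : ∀ i → Closed cl (Cs i)
  Cs-closed i = proj₁ (Cs-pred i)

  Cs⊆C : ∀ i → Cs i ⊆ C
  Cs⊆C i = proj₁ (proj₁ (proj₂ (Cs-pred i)))

  C⊆φQ : C ⊆ φ Q
  C⊆φQ = ⊆-reflexive (sym φQ≡C)

  Q⊆C : Q ⊆ C
  Q⊆C z∈ = ⊆-reflexive φQ≡C (extensive Q z∈)

  C*⊆Cs : ∀ i → C* ⊆ Cs i
  C*⊆Cs i z∈ = ∈⋂ᶠ⁻ Cs z∈ i

  φ⁅⁆≢C : ∀ y → φ ⁅ y ⁆ ≢ C
  φ⁅⁆≢C y φy≡C = C-notJI (subst (JoinIrreducible cl) φy≡C (φ⁅⁆-joinIrreducible y))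

  φ⁅⁆⊆Q : ∀ {y} → y ∈ Q → φ ⁅ y ⁆ ⊆ Q
  φ⁅⁆⊆Q {y} y∈Q = quasiClosed-φ Q-qc (⁅⁆-⊆ y∈Q) (λ φy≡φQ → φ⁅⁆≢C y (trans φy≡φQ φQ≡C))

  ⊆-some-Cs : ∀ {D} → Closed cl D → D ⊊ C → ∃ λ k → D ⊆ Cs k
  ⊆-some-Cs D-closed D⊊C with predecessor-above D-closed D⊊C
  ... | P , P-pred , D⊆P with Cs-all P P-pred
  ...   | k , refl = k , D⊆P

  ∈-some-Cs : ∀ {y} → y ∈ C → ∃ λ k → y ∈ Cs k
  ∈-some-Cs {y} y∈C with ⊆-some-Cs (idempotent ⁅ y ⁆) (φ⁅⁆-least C-closed y∈C , φ⁅⁆≢C y)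
  ... | k , φy⊆Cs = k , φy⊆Cs (y∈φ⁅y⁆ y)

  -- Essentiality of C is used only here: it makes C nonempty, so that C has a predecessor.
  some-Cs : Fin m
  some-Cs = from-pseudoClosed C-essential
    where
    from-pseudoClosed : Essential cl C → Fin m
    from-pseudoClosed (P , (P-notClosed , _) , φP≡C)
      with ⊈⇒∃ (λ φP⊆P → P-notClosed (⊆-antisym φP⊆P (extensive P)))
    ... | z , z∈φP , _ = proj₁ (∈-some-Cs (subst (z ∈_) φP≡C z∈φP))

  φ⊥⊆Q : φ ⊥ ⊆ Q
  φ⊥⊆Q = quasiClosed-φ Q-qc (⊆-min Q) λ φ⊥≡φQ →
    proj₂ (⊆-predecessor⇒⊊ (Cs-pred some-Cs) (φ-least (Cs-closed some-Cs) (⊆-min _))) (trans φ⊥≡φQ φQ≡C)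

  Cs⊆Q-through : ∀ {D y} → Closed cl D → D ⊆ Q → y ∈ Q → C ⊆ φ (⁅ y ⁆ ∪ D) →
                 ∃ λ b → y ∈ Cs b × Cs b ⊆ Q
  Cs⊆Q-through D-closed D⊆Q y∈Q C⊆ with ∈-some-Cs (Q⊆C y∈Q)
  ... | b , y∈Cs = b , y∈Cs ,
    predecessor-⊆-quasiClosed Q-qc (subst (Predecessor cl (Cs b)) (sym φQ≡C) (Cs-pred b))
                              D-closed D⊆Q y∈Q y∈Cs (λ z∈ → C⊆ (⊆-reflexive φQ≡C z∈))

  some-Cs⊆Q : ∃ λ a → Cs a ⊆ Q
  some-Cs⊆Q = from-maximal (maximal-closed-⊆ Q-qc (idempotent ⊥) φ⊥⊆Q)
    where
    from-maximal : (∃ λ M → Closed cl M × M ⊆ Q × (∀ {y} → y ∈ Q → y ∉ M → φ (⁅ y ⁆ ∪ M) ≡ φ Q)) →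
                   ∃ λ a → Cs a ⊆ Q
    from-maximal (M , M-closed , M⊆Q , M-maximal) with Q ⊆? M
    ... | yes Q⊆M = some-Cs , λ z∈ → M⊆Q (φ-least M-closed Q⊆M (C⊆φQ (Cs⊆C some-Cs z∈)))
    ... | no Q⊈M with ⊈⇒∃ Q⊈M
    ...   | y , y∈Q , y∉M =
      let b , _ , Csb⊆Q = Cs⊆Q-through {M} {y} M-closed M⊆Q y∈Q
                            (⊆-reflexive (sym (trans (M-maximal y∈Q y∉M) φQ≡C)))
      in b , Csb⊆Q

  two-Cs⊆Q : ∃₂ λ a b → Cs a ⊆ Q × Cs b ⊆ Q × Cs a ≢ Cs b
  two-Cs⊆Q =
    let a , Csa⊆Q = some-Cs⊆Q
        y , y∈Q , y∉Csa = ⊈⇒∃ (λ Q⊆Csa → predecessor-⊉ (Cs-pred a)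
                                           (λ z∈ → φ-least (Cs-closed a) Q⊆Csa (C⊆φQ z∈)))
        b , y∈Csb , Csb⊆Q = Cs⊆Q-through {Cs a} {y} (Cs-closed a) Csa⊆Q y∈Q
          (⊆-reflexive (sym (predecessor-join C-closed (Cs-pred a) (⁅⁆-⊆ (Q⊆C y∈Q)) (x∈⁅x⁆ y) y∉Csa)))
    in a , b , Csa⊆Q , Csb⊆Q , λ Csa≡Csb → y∉Csa (subst (y ∈_) (sym Csa≡Csb) y∈Csb)

  C*⊆Q : C* ⊆ Q
  C*⊆Q z∈ = proj₂ some-Cs⊆Q (C*⊆Cs (proj₁ some-Cs⊆Q) z∈)

  C*-closed : Closed cl C*
  C*-closed = ⋂ᶠ-closed Cs Cs-closed

  Cs≡-of-new : ∀ {i k a} → Cs i ─ C* ≡ ⁅ a ⁆ → a ∈ Cs k → Cs i ≡ Cs k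
  Cs≡-of-new {i} {k} Csi─C*≡⁅a⁆ a∈Csk = predecessor-⊆⇒≡ (Cs-pred i) (Cs-pred k) Csi⊆Csk
    where
    Csi⊆Csk : Cs i ⊆ Cs k
    Csi⊆Csk {z} z∈Csi with z ∈? C*
    ... | yes z∈C* = C*⊆Cs k z∈C*
    ... | no z∉C* = subst (_∈ Cs k) (sym (─≡⁅⁆⇒≡ Csi─C*≡⁅a⁆ z∈Csi z∉C*)) a∈Csk

  ∈Cs∋new⇒Q⁺ : ∀ {i k a x} → Cs i ─ C* ≡ ⁅ a ⁆ → a ∈ Cs k → x ∈ Cs k → Q⁺ x
  ∈Cs∋new⇒Q⁺ {i} {k} {a} {x} Csi─C*≡⁅a⁆ a∈Csk x∈Csk with x ∈? C*
  ... | yes x∈C* = inj₁ (C*⊆Q x∈C*)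
  ... | no x∉C* = inj₂ (i , subst (λ v → Cs i ─ C* ≡ ⁅ v ⁆) (sym x≡a) Csi─C*≡⁅a⁆)
    where
    x≡a : x ≡ a
    x≡a = ─≡⁅⁆⇒≡ Csi─C*≡⁅a⁆ (subst (x ∈_) (sym (Cs≡-of-new Csi─C*≡⁅a⁆ a∈Csk)) x∈Csk) x∉C*

  Q⁺⊆C : ∀ {y} → Q⁺ y → y ∈ C
  Q⁺⊆C (inj₁ y∈Q) = Q⊆C y∈Q
  Q⁺⊆C (inj₂ (i , Csi─C*≡⁅y⁆)) = Cs⊆C i (─≡⁅⁆⇒∈ Csi─C*≡⁅y⁆)

  Q⁺-closed-below-C : ∀ {A x} → (∀ {y} → y ∈ A → Q⁺ y) → φ A ≢ C → x ∈ φ A → Q⁺ x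
  Q⁺-closed-below-C {A} {x} A⊆Q⁺ φA≢C x∈φA with A ⊆? Q
  ... | yes A⊆Q = inj₁ (quasiClosed-φ Q-qc A⊆Q (λ φA≡φQ → φA≢C (trans φA≡φQ φQ≡C)) x∈φA)
  ... | no A⊈Q =
    let φA⊆C : φ A ⊆ C
        φA⊆C = φ-least C-closed λ y∈ → Q⁺⊆C (A⊆Q⁺ y∈)
        k , φA⊆Csk = ⊆-some-Cs (idempotent A) (φA⊆C , φA≢C)
        a , a∈A , a∉Q = ⊈⇒∃ A⊈Q
    in [ (λ a∈Q → ⊥-elim (a∉Q a∈Q))
       , (λ (i , Csi─C*≡⁅a⁆) → ∈Cs∋new⇒Q⁺ Csi─C*≡⁅a⁆ (φA⊆Csk (extensive A a∈A)) (φA⊆Csk x∈φA))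
       ]′ (A⊆Q⁺ a∈A)

  new-of-eGenerator : ∀ {A x} → EGenerator cl x A → φ A ≡ C → x ∉ Q → New x
  new-of-eGenerator {A} {x} A-gen φA≡C x∉Q =
    let j , x∈Csj = ∈-some-Cs (subst (x ∈_) φA≡C (proj₁ (proj₁ A-gen)))
        a , b , Csa⊆Q , Csb⊆Q , Csa≢Csb = two-Cs⊆Q
    in j , ─≡⁅⁆ x∈Csj (λ x∈C* → x∉Q (C*⊆Q x∈C*)) λ z∈Csj z≢x →
         ∈⋂ᶠ⁺ Cs λ l → ∈-every-predecessor (Cs-pred a) (Cs-pred b) Csa≢Csb (x∉Q ∘ Csa⊆Q) (x∉Q ∘ Csb⊆Q)
                                           (Cs-pred j) (Cs-pred l) x∈Csj z∈Csj z≢x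
    where open EGeneratorOf std A-gen φA≡C

  eGenerator-in-Q : ∀ {i x} → Cs i ─ C* ≡ ⁅ x ⁆ → x ∉ Q → ∃ λ B → EGenerator cl x B × B ⊆ Q
  eGenerator-in-Q {i} {x} Csi─C*≡⁅x⁆ x∉Q =
    let B , B-gen , φbB⊆φbQ = dGenerator-within x Q (C⊆φQ (Cs⊆C i (─≡⁅⁆⇒∈ Csi─C*≡⁅x⁆)))
                                                   (λ x∈ → x∉Q (φb-least φ⁅⁆⊆Q x∈))
    in B , (B-gen , minimal φbB⊆φbQ) , λ u∈ → φb-least φ⁅⁆⊆Q (φbB⊆φbQ (⊆φb B u∈))
    where
    minimal : ∀ {B} → φb cl B ⊆ φb cl Q → ∀ B' → DGenerator cl x B' → ¬ (φ B' ⊊ φ B)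
    minimal {B} φbB⊆φbQ B' (x∈φB' , x∉φbB' , _) (φB'⊆φB , φB'≢φB) =
      let k , φB'⊆Csk = ⊆-some-Cs (idempotent B') ((λ u∈ → φB⊆C (φB'⊆φB u∈)) , φB'≢C)
          φB'⊆Csi = subst (φ B' ⊆_) (sym (Cs≡-of-new Csi─C*≡⁅x⁆ (φB'⊆Csk x∈φB'))) φB'⊆Csk
      in ∉φ-of-─≡⁅⁆ C*-closed Csi─C*≡⁅x⁆ φB'⊆Csi x∉φbB' x∈φB'
      where
      φB⊆C : φ B ⊆ C
      φB⊆C u∈ = ⊆-reflexive φQ≡C (φ-mono-φb φbB⊆φbQ u∈)

      φB'≢C : φ B' ≢ C
      φB'≢C φB'≡C = φB'≢φB (⊆-antisym φB'⊆φB λ u∈ → ⊆-reflexive (sym φB'≡C) (φB⊆C u∈))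

  ERule-onto-C⇒EGenerator : ∀ {A x} → ERule cl A x → φ A ≡ C → EGenerator cl x A
  ERule-onto-C⇒EGenerator (inj₁ (a , refl , _)) φa≡C = ⊥-elim (φ⁅⁆≢C a φa≡C)
  ERule-onto-C⇒EGenerator (inj₂ A-gen) _ = A-gen

  sound : ∀ {x} → _∈ΣE_ cl x Q → Q⁺ x
  sound (base x∈Q) = inj₁ x∈Q
  sound {x} (step A rule premises) with φ A ≟ₛ C | x ∈? Q
  ... | _ | yes x∈Q = inj₁ x∈Q
  ... | yes φA≡C | no x∉Q = inj₂ (new-of-eGenerator (ERule-onto-C⇒EGenerator rule φA≡C) φA≡C x∉Q)
  ... | no φA≢C | no _ = Q⁺-closed-below-C (λ y∈A → sound (premises _ y∈A)) φA≢C (ERule⇒∈φ rule)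

  complete : ∀ {x} → Q⁺ x → _∈ΣE_ cl x Q
  complete (inj₁ x∈Q) = base x∈Q
  complete {x} (inj₂ (i , Csi─C*≡⁅x⁆)) with x ∈? Q
  ... | yes x∈Q = base x∈Q
  ... | no x∉Q = let B , B-gen , B⊆Q = eGenerator-in-Q Csi─C*≡⁅x⁆ x∉Q
                 in step B (inj₂ B-gen) λ _ y∈B → base (B⊆Q y∈B)

lemma6 : ∀ {n : ℕ} (cl : ClosureOp n) → Standard cl → Modular cl →
         (C : Subset n) → Essential cl C → ¬ JoinIrreducible cl C →
         (m : ℕ) (Cs : Fin m → Subset n) →
         (∀ i → Predecessor cl (Cs i) C) →
         (∀ P → Predecessor cl P C → ∃ λ i → Cs i ≡ P) →
         ∀ Q → QuasiClosed cl Q → ClosureOp.φ cl Q ≡ C →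
         ∀ x → (_∈ΣE_ cl x Q ⇔ (x ∈ Q ⊎ ∃ λ i → Cs i ─ ⋂ᶠ Cs ≡ ⁅ x ⁆))
lemma6 cl std mod C C-essential C-notJI m Cs Cs-pred Cs-all Q Q-qc φQ≡C x = mk⇔ sound complete
  where open EBaseClosure cl std mod C C-essential C-notJI m Cs Cs-pred Cs-all Q Q-qc φQ≡C
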